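{- The moon $\{\infty\,|\,\overline{\infty}\}$ is absorbing modulo $\mathbb{Im}^\infty$: for all $Y\in\mathbb{Im}^\infty$, $\{\infty\,|\,\overline{\infty}\}+Y=_{\mathbb{Im}^\infty}\{\infty\,|\,\overline{\infty}\}$.
   Context: Affine normal play forms are built from terminating games $\infty$ (Left wins) and $\overline{\infty}$ (Right wins), with $\infty+X=\infty$ for $X\neq\overline{\infty}$ and $\overline{\infty}+X=\overline{\infty}$ for $X\neq\infty$. $\mathbb{Im}^\infty$ is the class of affine impartial forms: symmetric forms (Right options are conjugates of Left options) all of whose quiet (non-check, non-infinity) followers are symmetric. $G=_{\mathbb{Im}^\infty}H$ means $o(G+X)=o(H+X)$ for every $X\in\mathbb{Im}^\infty$. The moon is the form $\{\infty\,|\,\overline{\infty}\}$, in which the first player to move wins. -}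

module Defs where

open import Data.Bool using (Bool; true; false; _∧_; _∨_)
open import Data.List using (List; []; _∷_)
open import Data.List.Relation.Unary.All using (All)
open import Data.List.Relation.Unary.Any using (Any)
open import Data.List.Membership.Propositional using (_∈_)
open import Data.Product using (_×_)
open import Data.Sum using (_⊎_)
open import Data.Empty using (⊥)
open import Relation.Nullary using (¬_)
open import Relation.Binary.PropositionalEquality using (_≡_)

-- A form is ∞ (Left wins), -∞ (overline ∞, Right wins), or { L | R }
-- given by finite lists of Left and Right options (read as sets, see ≅).

data Form : Set where
  ∞  : Form
  -∞ : Form
  ⟨_∣_⟩ : List Form → List Form → Form

-- Identity of forms as set-based objects: options compared as sets,
-- recursively (order and repetition of list entries are irrelevant).
data _≅_ : Form → Form → Set where
  ∞≅  : ∞ ≅ ∞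
  -∞≅ : -∞ ≅ -∞
  opt≅ : ∀ {a b c d} →
         All (λ x → Any (λ y → x ≅ y) c) a →
         All (λ y → Any (λ x → x ≅ y) a) c →
         All (λ x → Any (λ y → x ≅ y) d) b →
         All (λ y → Any (λ x → x ≅ y) b) d →
         ⟨ a ∣ b ⟩ ≅ ⟨ c ∣ d ⟩

_≈ₛ_ : List Form → List Form → Set
xs ≈ₛ ys = All (λ x → Any (λ y → x ≅ y) ys) xs × All (λ y → Any (λ x → x ≅ y) xs) ys

mutual
  conj : Form → Form
  conj ∞ = -∞
  conj -∞ = ∞
  conj ⟨ L ∣ R ⟩ = ⟨ conjs R ∣ conjs L ⟩

  conjs : List Form → List Form
  conjs [] = []
  conjs (x ∷ xs) = conj x ∷ conjs xs

-- Disjunctive sum.  ∞ + X = ∞ (X ≠ -∞), -∞ + X = -∞ (X ≠ ∞); the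
-- case ∞ + -∞ is undefined in the paper and never arises in sums of
-- non-infinite forms; here it is (arbitrarily) resolved to the left summand.
mutual
  infixl 6 _+_
  _+_ : Form → Form → Form
  ∞ + H = ∞
  -∞ + H = -∞
  ⟨ GL ∣ GR ⟩ + ∞ = ∞
  ⟨ GL ∣ GR ⟩ + -∞ = -∞
  ⟨ GL ∣ GR ⟩ + ⟨ HL ∣ HR ⟩ =
    ⟨ plusL GL ⟨ HL ∣ HR ⟩ ++ plusR ⟨ GL ∣ GR ⟩ HL
    ∣ plusL GR ⟨ HL ∣ HR ⟩ ++ plusR ⟨ GL ∣ GR ⟩ HR ⟩

  plusL : List Form → Form → List Form
  plusL [] H = []
  plusL (x ∷ xs) H = (x + H) ∷ plusL xs H

  plusR : Form → List Form → List Form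
  plusR G [] = []
  plusR G (y ∷ ys) = (G + y) ∷ plusR G ys

  _++_ : List Form → List Form → List Form
  [] ++ ys = ys
  (x ∷ xs) ++ ys = x ∷ (xs ++ ys)

-- Outcomes.  leftFirst G : Left wins G moving first;
-- leftSecond G : Left wins G when Right moves first.
-- ∞ is a win for Left, -∞ a win for Right, whoever is to move;
-- otherwise normal play (a player with no move loses).

mutual
  leftFirst : Form → Bool
  leftFirst ∞ = true
  leftFirst -∞ = false
  leftFirst ⟨ L ∣ R ⟩ = anyLeftSecond L

  leftSecond : Form → Bool
  leftSecond ∞ = true
  leftSecond -∞ = false
  leftSecond ⟨ L ∣ R ⟩ = allLeftFirst R

  anyLeftSecond : List Form → Bool
  anyLeftSecond [] = false
  anyLeftSecond (x ∷ xs) = leftSecond x ∨ anyLeftSecond xs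

  allLeftFirst : List Form → Bool
  allLeftFirst [] = true
  allLeftFirst (x ∷ xs) = leftFirst x ∧ allLeftFirst xs

data Outcome : Set where
  𝓛 𝓝 𝓟 𝓡 : Outcome

outcomeOf : Bool → Bool → Outcome
outcomeOf true  true  = 𝓛
outcomeOf true  false = 𝓝
outcomeOf false true  = 𝓟
outcomeOf false false = 𝓡

o : Form → Outcome
o G = outcomeOf (leftFirst G) (leftSecond G)

IsCheck : Form → Set
IsCheck ∞ = ⊥
IsCheck -∞ = ⊥
IsCheck ⟨ L ∣ R ⟩ = (∞ ∈ L) ⊎ (-∞ ∈ R)

Quiet : Form → Set
Quiet ∞ = ⊥
Quiet -∞ = ⊥
Quiet ⟨ L ∣ R ⟩ = ¬ IsCheck ⟨ L ∣ R ⟩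

Symmetric : Form → Set
Symmetric ∞ = ⊥
Symmetric -∞ = ⊥
Symmetric ⟨ L ∣ R ⟩ = R ≈ₛ conjs L

data Follower : Form → Form → Set where
  self : ∀ {G} → Follower G G
  viaL : ∀ {L R x F} → x ∈ L → Follower x F → Follower ⟨ L ∣ R ⟩ F
  viaR : ∀ {L R x F} → x ∈ R → Follower x F → Follower ⟨ L ∣ R ⟩ F

Im∞ : Form → Set
Im∞ G = Symmetric G × (∀ F → Follower G F → Quiet F → Symmetric F)

_≡Im∞_ : Form → Form → Set
G ≡Im∞ H = ∀ X → Im∞ X → o (G + X) ≡ o (H + X)

moon : Form
moon = ⟨ ∞ ∷ [] ∣ -∞ ∷ [] ⟩

{-# OPTIONS --safe #-}
module Submission where

-- Moving in the moon wins at once, so the moon keeps a winning move for each player in any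
-- sum with non-infinite forms: moon + Y + X and moon + X are both first-player wins.

open import Defs
open import Data.Bool using (true; false)
open import Data.Bool.Properties using (∨-zeroʳ; ∧-zeroʳ)
open import Data.Empty using (⊥)
open import Data.List using (_∷_)
open import Data.List.Membership.Propositional using (_∈_)
open import Data.List.Relation.Unary.Any using (here; there)
open import Data.Product using (_×_; _,_)
open import Relation.Binary.PropositionalEquality using (_≡_; refl; sym; cong₂; module ≡-Reasoning)

DoubleCheck : Form → Set
DoubleCheck ∞ = ⊥
DoubleCheck -∞ = ⊥
DoubleCheck ⟨ L ∣ R ⟩ = (∞ ∈ L) × (-∞ ∈ R)

anyLeftSecond-∞ : ∀ {xs} → ∞ ∈ xs → anyLeftSecond xs ≡ true
anyLeftSecond-∞ (here refl) = refl
anyLeftSecond-∞ {x ∷ _} (there p) rewrite anyLeftSecond-∞ p = ∨-zeroʳ (leftSecond x)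

allLeftFirst--∞ : ∀ {xs} → -∞ ∈ xs → allLeftFirst xs ≡ false
allLeftFirst--∞ (here refl) = refl
allLeftFirst--∞ {x ∷ _} (there p) rewrite allLeftFirst--∞ p = ∧-zeroʳ (leftFirst x)

o-doubleCheck : ∀ G → DoubleCheck G → o G ≡ 𝓝
o-doubleCheck ⟨ L ∣ R ⟩ (∞∈L , -∞∈R) =
  cong₂ outcomeOf (anyLeftSecond-∞ ∞∈L) (allLeftFirst--∞ -∞∈R)

∈-++⁺ˡ : ∀ {x : Form} {xs ys} → x ∈ xs → x ∈ xs ++ ys
∈-++⁺ˡ (here refl) = here refl
∈-++⁺ˡ (there p) = there (∈-++⁺ˡ p)

∈-plusL⁺ : ∀ {x xs} H → x ∈ xs → x + H ∈ plusL xs H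
∈-plusL⁺ H (here refl) = here refl
∈-plusL⁺ H (there p) = there (∈-plusL⁺ H p)

doubleCheck-+ : ∀ G {L R} → DoubleCheck G → DoubleCheck (G + ⟨ L ∣ R ⟩)
doubleCheck-+ ⟨ _ ∣ _ ⟩ {L} {R} (∞∈GL , -∞∈GR) =
  ∈-++⁺ˡ (∈-plusL⁺ ⟨ L ∣ R ⟩ ∞∈GL) , ∈-++⁺ˡ (∈-plusL⁺ ⟨ L ∣ R ⟩ -∞∈GR)

moon-doubleCheck : DoubleCheck moon
moon-doubleCheck = here refl , here refl

theorem3p22 : ∀ Y → Im∞ Y → (moon + Y) ≡Im∞ moon
theorem3p22 ∞ (() , _)
theorem3p22 -∞ (() , _)
theorem3p22 ⟨ _ ∣ _ ⟩ _ ∞ (() , _)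
theorem3p22 ⟨ _ ∣ _ ⟩ _ -∞ (() , _)
theorem3p22 Y@(⟨ _ ∣ _ ⟩) _ X@(⟨ _ ∣ _ ⟩) _ = begin
  o (moon + Y + X)  ≡⟨ o-doubleCheck (moon + Y + X) (doubleCheck-+ (moon + Y) (doubleCheck-+ moon moon-doubleCheck)) ⟩
  𝓝                 ≡⟨ sym (o-doubleCheck (moon + X) (doubleCheck-+ moon moon-doubleCheck)) ⟩
  o (moon + X)      ∎
  where open ≡-Reasoning
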